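{- Let $\mathcal F$ be a family of dangers, let $r\ge1$ be an integer, and let $H$ be a marked hypergraph with $|V(H)\setminus M(H)|\ge 2r$. If $H$ is a Breaker win, then $J_r(\mathcal F,H)$ holds.
   Context: A marked hypergraph $H$: finite nonempty $V(H)$, edge set $E(H)$ of nonempty subsets of $V(H)$, marked set $M(H)\subseteq V(H)$. Subhypergraph $X$: $V(X)\subseteq V(H)$, $E(X)\subseteq E(H)$, $M(X)=V(X)\cap M(H)$. $H^{+x}$ marks non-marked $x$; $H^{ -y}$ deletes $y$ and all edges containing it; composed left to right. Trivial Maker win: some edge $e$ with $|e\setminus M(H)|\le1$. Maker win (recursive): if $|V(H)\setminus M(H)|\le1$, iff trivial Maker win; otherwise iff some non-marked $x$ has $H^{+x-y}$ a Maker win for all non-marked $y\ne x$; otherwise Breaker win. A pointed marked hypergraph is $(D,x)$ with $x\in V(D)\setminus M(D)$; isomorphism of pointed marked hypergraphs is a bijection preserving edges, marked vertices and the point. A family of dangers is a family $\mathcal F$ of pointed marked hypergraphs such that $D^{+x}$ is a Maker win for each $(D,x)\in\mathcal F$. $x\mathcal F(H)$: subhypergraphs $X\ni x$ of $H$ with $(X,x)$ isomorphic to a member of $\mathcal F$. $\mathrm{Int}_H(\mathcal X)$: set of non-marked vertices of $H$ lying in every member of $\mathcal X$. $J_1(\mathcal F,H)$: for every $x\in V(H)\setminus M(H)$, $\mathrm{Int}_{H^{+x}}(x\mathcal F(H))\ne\varnothing$. For $r\ge2$: $J_r(\mathcal F,H)$ means for every $x\in V(H)\setminus M(H)$ there is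 $y\in\mathrm{Int}_{H^{+x}}(x\mathcal F(H))$ with $J_{r-1}(\mathcal F,H^{+x-y})$. -}

module Defs where

open import Level using (Level; 0ℓ) renaming (suc to lsuc)
open import Data.Nat using (ℕ; zero; suc; _≤_)
open import Data.Fin using (Fin)
open import Data.Fin.Subset using (Subset; _∈_; _∉_; _⊆_; _∩_; _∪_; _─_; _-_; ⁅_⁆; ∣_∣; Nonempty)
open import Data.Fin.Subset.Properties using (_∈?_)
open import Data.List using (List; filter)
import Data.List.Membership.Propositional as LM
open import Data.Product using (Σ; ∃; _×_)
open import Data.Unit using (⊤)
open import Relation.Nullary using (¬_; ¬?)
open import Relation.Binary.PropositionalEquality using (_≡_; _≢_)
open import Function.Bundles using (_⇔_)

-- A marked hypergraph whose vertices live in an ambient finite set Fin n.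
-- V(H) ⊆ Fin n, E(H) a finite set of subsets (given as a list; only
-- membership matters), M(H) ⊆ V(H).
record MHG (n : ℕ) : Set where
  constructor mhg
  field
    V : Subset n
    E : List (Subset n)
    M : Subset n
open MHG public

_∈E_ : ∀ {n} → Subset n → List (Subset n) → Set
e ∈E es = e LM.∈ es

record WF {n} (H : MHG n) : Set where
  field
    V-nonempty : Nonempty (V H)
    E-nonempty : ∀ e → e ∈E E H → Nonempty e
    E-sub      : ∀ e → e ∈E E H → e ⊆ V H
    M-sub      : M H ⊆ V H

unmarked : ∀ {n} → MHG n → Subset n
unmarked H = V H ─ M H

_⁺_ : ∀ {n} → MHG n → Fin n → MHG n
H ⁺ x = mhg (V H) (E H) (M H ∪ ⁅ x ⁆)

_⁻_ : ∀ {n} → MHG n → Fin n → MHG n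
H ⁻ y = mhg (V H - y) (filter (λ e → ¬? (y ∈? e)) (E H)) (M H - y)

infixl 6 _⁺_ _⁻_

TrivialMakerWin : ∀ {n} → MHG n → Set
TrivialMakerWin H = Σ (Subset _) λ e → e ∈E E H × ∣ e ─ M H ∣ ≤ 1

-- Maker win, the recursive definition (recursion on |V(H) \ M(H)|,
-- which strictly decreases), rendered as an inductive predicate.
data MakerWin {n : ℕ} : MHG n → Set where
  base : ∀ {H} → ∣ unmarked H ∣ ≤ 1 → TrivialMakerWin H → MakerWin H
  step : ∀ {H} → 2 ≤ ∣ unmarked H ∣ →
         (x : Fin n) → x ∈ unmarked H →
         (∀ y → y ∈ unmarked H → y ≢ x → MakerWin (H ⁺ x ⁻ y)) →
         MakerWin H

BreakerWin : ∀ {n} → MHG n → Set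
BreakerWin H = ¬ MakerWin H

record Subhypergraph {n} (X H : MHG n) : Set where
  field
    wf    : WF X
    V-sub : V X ⊆ V H
    E-sub : ∀ e → e ∈E E X → e ∈E E H
    M-eq  : M X ≡ V X ∩ M H

IsImage : ∀ {n m} → (Fin n → Fin m) → Subset n → Subset m → Set
IsImage f e e' = ∀ w → (w ∈ e') ⇔ (Σ (Fin _) λ v → v ∈ e × f v ≡ w)

record PointedIso {n m} (X : MHG n) (x : Fin n) (D : MHG m) (d : Fin m) : Set where
  field
    f     : Fin n → Fin m
    g     : Fin m → Fin n
    f-V   : ∀ v → v ∈ V X → f v ∈ V D
    g-V   : ∀ w → w ∈ V D → g w ∈ V X
    gf    : ∀ v → v ∈ V X → g (f v) ≡ v
    fg    : ∀ w → w ∈ V D → f (g w) ≡ w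
    E-fwd : ∀ e → e ∈E E X → Σ (Subset m) λ e' → e' ∈E E D × IsImage f e e'
    E-bwd : ∀ e' → e' ∈E E D → Σ (Subset n) λ e → e ∈E E X × IsImage f e e'
    M-pres : ∀ v → v ∈ V X → (v ∈ M X) ⇔ (f v ∈ M D)
    point : f x ≡ d

Family : Set₁
Family = (m : ℕ) → MHG m → Fin m → Set

IsFamilyOfDangers : Family → Set
IsFamilyOfDangers F = ∀ m (D : MHG m) (d : Fin m) → F m D d →
  WF D × d ∈ unmarked D × MakerWin (D ⁺ d)

InXF : Family → ∀ {n} → MHG n → Fin n → MHG n → Set
InXF F H x X = Subhypergraph X H × x ∈ V X ×
  Σ ℕ λ m → Σ (MHG m) λ D → Σ (Fin m) λ d → F m D d × PointedIso X x D d

InInt : Family → ∀ {n} → MHG n → Fin n → Fin n → Set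
InInt F H x y = y ∈ unmarked (H ⁺ x) × (∀ X → InXF F H x X → y ∈ V X)

-- J_r(F,H) for r ≥ 1 (J 0 is unused filler)
J : ℕ → Family → ∀ {n} → MHG n → Set
J zero F H = ⊤
J (suc zero) F H = ∀ x → x ∈ unmarked H → Σ _ λ y → InInt F H x y
J (suc (suc r)) F H = ∀ x → x ∈ unmarked H →
  Σ _ λ y → InInt F H x y × J (suc r) F (H ⁺ x ⁻ y)

-- Maker-Breaker games on finite hypergraphs are determined, so when Breaker wins H
-- every Maker move x has a reply y with H⁺ˣ⁻ʸ still a Breaker win. Such a reply lies
-- in every danger (X, x) of H: if X avoided y, then D⁺ᵈ ≅ X⁺ˣ would sit inside
-- H⁺ˣ⁻ʸ, and Maker's win on D⁺ᵈ transfers to the larger board. Each round removes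
-- at most two unmarked vertices, so 2r of them allow r rounds.
module Submission where

open import Defs
open import Data.Nat using (ℕ; zero; suc; _≤_; _<_; _*_; z≤n; s≤s; _≤?_)
open import Data.Nat.Properties
  using (≤-refl; ≤-trans; n≤1+n; module ≤-Reasoning; ≤-pred; ≤-reflexive; ≤-<-trans; ≰⇒>; *-suc)
open import Data.Fin using (Fin; zero; suc; _≟_)
open import Data.Fin.Properties using (any?; all?)
open import Data.Fin.Subset
  using (Subset; _∈_; _∉_; _⊆_; _∪_; _─_; _-_; ⁅_⁆; ∣_∣; Nonempty; Empty; inside; outside)
open import Data.Fin.Subset.Properties
  using ( _∈?_; nonempty?; Empty-unique; ∣⊥∣≡0; ∣⁅x⁆∣≡1; x∈⁅x⁆; x∈⁅y⁆⇒x≡y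
        ; x≢y⇒x∉⁅y⁆; x∉⁅y⁆⇒x≢y; p⊆q⇒∣p∣≤∣q∣; p⊂q⇒∣p∣<∣q∣; x∈p∪q⁻; x∈p∪q⁺
        ; ∪-identityʳ; x∈p∧x∉q⇒x∈p─q; p─q⊆p; x∈p∧x≢y⇒x∈p-y; x∈p⇒∣p-x∣<∣p∣
        ; x∈p∩q⁺; x∈p∩q⁻)
open import Data.Vec.Base using (_∷_; there)
open import Data.List.Membership.Propositional using (find; lose)
open import Data.List.Membership.Propositional.Properties using (∈-filter⁺; ∈-filter⁻)
open import Data.List.Relation.Unary.Any using () renaming (any? to anyEdge?)
open import Data.Product using (∃; _×_; _,_; proj₁; proj₂)
open import Data.Sum using (_⊎_; inj₁; inj₂; [_,_])
open import Function using (_∘_)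
open import Function.Bundles using (Equivalence)
open import Relation.Nullary using (¬?; Dec; yes; no; contradiction)
open import Relation.Nullary.Decidable using (map′; _×-dec_; _→-dec_)
open import Relation.Binary.PropositionalEquality using (_≡_; _≢_; refl; sym; trans; cong; subst)

private
  variable
    m n : ℕ
    p q : Subset n
    e : Subset n
    v x y : Fin n

x∈p─q⇒x∉q : ∀ (p q : Subset n) → x ∈ p ─ q → x ∉ q
x∈p─q⇒x∉q (_ ∷ p) (outside ∷ q) (there x∈) (there x∈q) = x∈p─q⇒x∉q p q x∈ x∈q
x∈p─q⇒x∉q (_ ∷ p) (inside ∷ q)  (there x∈) (there x∈q) = x∈p─q⇒x∉q p q x∈ x∈q

x∈p─q⁻ : ∀ (p q : Subset n) → x ∈ p ─ q → x ∈ p × x ∉ q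
x∈p─q⁻ p q x∈ = p─q⊆p p q x∈ , x∈p─q⇒x∉q p q x∈

x∈p-y⁻ : ∀ (p : Subset n) → x ∈ p - y → x ∈ p × x ≢ y
x∈p-y⁻ {y = y} p x∈ = p─q⊆p p ⁅ y ⁆ x∈ , x∉⁅y⁆⇒x≢y (x∈p─q⇒x∉q p ⁅ y ⁆ x∈)

x∈p∪⁅y⁆⁻ : ∀ (p : Subset n) → x ∈ p ∪ ⁅ y ⁆ → x ∈ p ⊎ x ≡ y
x∈p∪⁅y⁆⁻ {y = y} p x∈ with x∈p∪q⁻ p ⁅ y ⁆ x∈
... | inj₁ x∈p = inj₁ x∈p
... | inj₂ x∈y = inj₂ (x∈⁅y⁆⇒x≡y y x∈y)

x∈p∪⁅y⁆⁺ : x ∈ p ⊎ x ≡ y → x ∈ p ∪ ⁅ y ⁆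
x∈p∪⁅y⁆⁺ (inj₁ x∈p)         = x∈p∪q⁺ (inj₁ x∈p)
x∈p∪⁅y⁆⁺ {x = x} (inj₂ refl) = x∈p∪q⁺ (inj₂ (x∈⁅x⁆ x))

∣p∪⁅x⁆∣≤1+∣p∣ : ∀ (p : Subset n) x → ∣ p ∪ ⁅ x ⁆ ∣ ≤ suc ∣ p ∣
∣p∪⁅x⁆∣≤1+∣p∣ (outside ∷ p) zero    rewrite ∪-identityʳ p = ≤-refl
∣p∪⁅x⁆∣≤1+∣p∣ (inside ∷ p)  zero    rewrite ∪-identityʳ p = n≤1+n _
∣p∪⁅x⁆∣≤1+∣p∣ (outside ∷ p) (suc x) = ∣p∪⁅x⁆∣≤1+∣p∣ p x
∣p∪⁅x⁆∣≤1+∣p∣ (inside ∷ p)  (suc x) = s≤s (∣p∪⁅x⁆∣≤1+∣p∣ p x)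

Empty⇒∣p∣≡0 : Empty p → ∣ p ∣ ≡ 0
Empty⇒∣p∣≡0 {n} empty = trans (cong ∣_∣ (Empty-unique empty)) (∣⊥∣≡0 n)

1≤∣p∣⇒Nonempty : ∀ (p : Subset n) → 1 ≤ ∣ p ∣ → Nonempty p
1≤∣p∣⇒Nonempty p 1≤ with nonempty? p
... | yes nonempty = nonempty
... | no empty     = contradiction (subst (1 ≤_) (Empty⇒∣p∣≡0 empty) 1≤) λ ()

p⊆⁅x⁆⇒∣p∣≤1 : p ⊆ ⁅ x ⁆ → ∣ p ∣ ≤ 1
p⊆⁅x⁆⇒∣p∣≤1 {x = x} p⊆ = ≤-trans (p⊆q⇒∣p∣≤∣q∣ p⊆) (≤-reflexive (∣⁅x⁆∣≡1 x))

x≢y⇒2≤∣p∣ : x ∈ p → y ∈ p → x ≢ y → 2 ≤ ∣ p ∣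
x≢y⇒2≤∣p∣ {x = x} {p = p} {y = y} x∈ y∈ x≢y = subst (_< ∣ p ∣) (∣⁅x⁆∣≡1 y)
  (p⊂q⇒∣p∣<∣q∣ ((λ v∈ → subst (_∈ p) (sym (x∈⁅y⁆⇒x≡y y v∈)) y∈) , x , x∈ , x≢y⇒x∉⁅y⁆ x≢y))

2≤∣p∣⇒another : ∀ (p : Subset n) → 2 ≤ ∣ p ∣ → x ∈ p → ∃ λ y → y ∈ p × y ≢ x
2≤∣p∣⇒another {x = x} p 2≤ x∈ with any? (λ y → (y ∈? p) ×-dec ¬? (y ≟ x))
... | yes another = another
... | no none     = contradiction (≤-trans 2≤ (p⊆⁅x⁆⇒∣p∣≤1 p⊆⁅x⁆)) λ { (s≤s ()) }
  where
  p⊆⁅x⁆ : p ⊆ ⁅ x ⁆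
  p⊆⁅x⁆ {y} y∈ with y ≟ x
  ... | yes refl = x∈⁅x⁆ x
  ... | no y≢x   = contradiction (y , y∈ , y≢x) none

AtMostOne : Subset n → Set
AtMostOne p = ∀ {v w} → v ∈ p → w ∈ p → v ≡ w

∣p∣≤1⇒AtMostOne : ∣ p ∣ ≤ 1 → AtMostOne p
∣p∣≤1⇒AtMostOne ≤1 {v} {w} v∈ w∈ with v ≟ w
... | yes v≡w = v≡w
... | no v≢w  = contradiction (≤-trans (x≢y⇒2≤∣p∣ v∈ w∈ v≢w) ≤1) λ { (s≤s ()) }

AtMostOne⇒∣p∣≤1 : ∀ (p : Subset n) → AtMostOne p → ∣ p ∣ ≤ 1
AtMostOne⇒∣p∣≤1 p one with nonempty? p
... | yes (v , v∈) = p⊆⁅x⁆⇒∣p∣≤1 λ w∈ → subst (_∈ ⁅ v ⁆) (one v∈ w∈) (x∈⁅x⁆ v)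
... | no empty     = ≤-trans (≤-reflexive (Empty⇒∣p∣≡0 empty)) z≤n

AtMostOne-⊆ : p ⊆ q → AtMostOne q → AtMostOne p
AtMostOne-⊆ p⊆q one v∈ w∈ = one (p⊆q v∈) (p⊆q w∈)

AtMostOne-image : ∀ {p : Subset m} {q : Subset n} (h : Fin m → Fin n) →
  (∀ {w} → w ∈ q → ∃ λ v → v ∈ p × h v ≡ w) → AtMostOne p → AtMostOne q
AtMostOne-image h covered one w∈ w′∈ with covered w∈ | covered w′∈
... | v , v∈ , refl | v′ , v′∈ , refl = cong h (one v∈ v′∈)

-- One round: Maker marks x, Breaker deletes y

∈unmarked-mark⁺ : ∀ (H : MHG n) → v ∈ unmarked H → v ≢ x → v ∈ unmarked (H ⁺ x)
∈unmarked-mark⁺ H v∈ v≢x with x∈p─q⁻ (V H) (M H) v∈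
... | v∈V , v∉M = x∈p∧x∉q⇒x∈p─q v∈V ([ v∉M , v≢x ] ∘ x∈p∪⁅y⁆⁻ (M H))

∈unmarked-round⁺ : ∀ (H : MHG n) → v ∈ unmarked H → v ≢ x → v ≢ y → v ∈ unmarked (H ⁺ x ⁻ y)
∈unmarked-round⁺ H v∈ v≢x v≢y with x∈p─q⁻ (V H) (M H) v∈
... | v∈V , v∉M = x∈p∧x∉q⇒x∈p─q (x∈p∧x≢y⇒x∈p-y v∈V v≢y)
  ([ v∉M , v≢x ] ∘ x∈p∪⁅y⁆⁻ (M H) ∘ proj₁ ∘ x∈p-y⁻ (M H ∪ ⁅ _ ⁆))

∈unmarked-round⁻ : ∀ (H : MHG n) → v ∈ unmarked (H ⁺ x ⁻ y) → v ∈ unmarked H × v ≢ x × v ≢ y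
∈unmarked-round⁻ {x = x} {y = y} H v∈ with x∈p─q⁻ (V H - y) ((M H ∪ ⁅ x ⁆) - y) v∈
... | v∈V-y , v∉M′ with x∈p-y⁻ (V H) v∈V-y
... | v∈V , v≢y =
  x∈p∧x∉q⇒x∈p─q v∈V (λ v∈M → v∉M′ (x∈p∧x≢y⇒x∈p-y (x∈p∪⁅y⁆⁺ (inj₁ v∈M)) v≢y)) ,
  (λ v≡x → v∉M′ (x∈p∧x≢y⇒x∈p-y (x∈p∪⁅y⁆⁺ (inj₂ v≡x)) v≢y)) ,
  v≢y

∣unmarked-round∣<∣unmarked∣ : ∀ (H : MHG n) → x ∈ unmarked H →
  ∣ unmarked (H ⁺ x ⁻ y) ∣ < ∣ unmarked H ∣
∣unmarked-round∣<∣unmarked∣ {x = x} {y = y} H x∈ =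
  ≤-<-trans (p⊆q⇒∣p∣≤∣q∣ round⊆) (x∈p⇒∣p-x∣<∣p∣ x∈)
  where
  round⊆ : unmarked (H ⁺ x ⁻ y) ⊆ unmarked H - x
  round⊆ v∈ with ∈unmarked-round⁻ H v∈
  ... | v∈U , v≢x , _ = x∈p∧x≢y⇒x∈p-y v∈U v≢x

∣unmarked∣≤2+∣unmarked-round∣ : ∀ (H : MHG n) x y →
  ∣ unmarked H ∣ ≤ suc (suc ∣ unmarked (H ⁺ x ⁻ y) ∣)
∣unmarked∣≤2+∣unmarked-round∣ H x y = begin
  ∣ unmarked H ∣                             ≤⟨ p⊆q⇒∣p∣≤∣q∣ ⊆round∪⁅x⁆∪⁅y⁆ ⟩
  ∣ (unmarked (H ⁺ x ⁻ y) ∪ ⁅ x ⁆) ∪ ⁅ y ⁆ ∣ ≤⟨ ∣p∪⁅x⁆∣≤1+∣p∣ (unmarked (H ⁺ x ⁻ y) ∪ ⁅ x ⁆) y ⟩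
  suc ∣ unmarked (H ⁺ x ⁻ y) ∪ ⁅ x ⁆ ∣       ≤⟨ s≤s (∣p∪⁅x⁆∣≤1+∣p∣ (unmarked (H ⁺ x ⁻ y)) x) ⟩
  suc (suc ∣ unmarked (H ⁺ x ⁻ y) ∣)         ∎
  where
  open ≤-Reasoning
  ⊆round∪⁅x⁆∪⁅y⁆ : unmarked H ⊆ (unmarked (H ⁺ x ⁻ y) ∪ ⁅ x ⁆) ∪ ⁅ y ⁆
  ⊆round∪⁅x⁆∪⁅y⁆ {v} v∈ with v ≟ x | v ≟ y
  ... | yes v≡x | _       = x∈p∪⁅y⁆⁺ (inj₁ (x∈p∪⁅y⁆⁺ (inj₂ v≡x)))
  ... | no _    | yes v≡y = x∈p∪⁅y⁆⁺ (inj₂ v≡y)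
  ... | no v≢x  | no v≢y  = x∈p∪⁅y⁆⁺ (inj₁ (x∈p∪⁅y⁆⁺ (inj₁ (∈unmarked-round⁺ H v∈ v≢x v≢y))))

∈E-delete⁺ : ∀ (H : MHG n) → e ∈E E H → y ∉ e → e ∈E E (H ⁻ y)
∈E-delete⁺ {y = y} H e∈ y∉ = ∈-filter⁺ (λ e → ¬? (y ∈? e)) e∈ y∉

∈E-delete⁻ : ∀ (H : MHG n) → e ∈E E (H ⁻ y) → e ∈E E H × y ∉ e
∈E-delete⁻ {y = y} H = ∈-filter⁻ (λ e → ¬? (y ∈? e))

∈p∪⁅x⁆-y⁻ : ∀ (p : Subset n) → v ∈ (p ∪ ⁅ x ⁆) - y → (v ∈ p ⊎ v ≡ x) × v ≢ y
∈p∪⁅x⁆-y⁻ {x = x} p v∈ with x∈p-y⁻ (p ∪ ⁅ x ⁆) v∈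
... | v∈p∪x , v≢y = x∈p∪⁅y⁆⁻ p v∈p∪x , v≢y

-- Unlike MakerWin, a trivial win may be claimed at any stage, and "at least two
-- unmarked vertices" is witnessed by a vertex y₀ ≢ x: both are preserved when the
-- board is embedded into a larger one.
data MakerWin′ (H : MHG n) : Set where
  trivial : ∀ e → e ∈E E H → AtMostOne (e ─ M H) → MakerWin′ H
  move    : ∀ x → x ∈ unmarked H → ∀ y₀ → y₀ ∈ unmarked H → y₀ ≢ x →
            (∀ y → y ∈ unmarked H → y ≢ x → MakerWin′ (H ⁺ x ⁻ y)) → MakerWin′ H

-- Maker marks the unique unmarked vertex of e, if any; then every reply of Breaker misses e.
trivialWinningMove : ∀ (H : MHG n) → Nonempty (unmarked H) → AtMostOne (e ─ M H) →
  ∃ λ x → x ∈ unmarked H × (∀ {y} → y ∈ unmarked H → y ≢ x → y ∉ e)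
trivialWinningMove {e = e} H (x₀ , x₀∈) one
  with any? (λ z → (z ∈? (e ─ M H)) ×-dec (z ∈? unmarked H))
... | yes (z , z∈e─M , z∈U) = z , z∈U , λ y∈U y≢z y∈e → y≢z (one (e─M y∈U y∈e) z∈e─M)
  where
  e─M : y ∈ unmarked H → y ∈ e → y ∈ e ─ M H
  e─M y∈U y∈e = x∈p∧x∉q⇒x∈p─q y∈e (proj₂ (x∈p─q⁻ (V H) (M H) y∈U))
... | no none = x₀ , x₀∈ , λ {y} y∈U _ y∈e →
  none (y , x∈p∧x∉q⇒x∈p─q y∈e (proj₂ (x∈p─q⁻ (V H) (M H) y∈U)) , y∈U)

e─marked-round⊆e─marked : ∀ (H : MHG n) → y ∉ e → e ─ M (H ⁺ x ⁻ y) ⊆ e ─ M H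
e─marked-round⊆e─marked {y = y} {e = e} {x = x} H y∉e v∈ with x∈p─q⁻ e _ v∈
... | v∈e , v∉M′ = x∈p∧x∉q⇒x∈p─q v∈e λ v∈M →
  v∉M′ (x∈p∧x≢y⇒x∈p-y (x∈p∪⁅y⁆⁺ (inj₁ v∈M)) λ { refl → y∉e v∈e })

trivial⇒MakerWin : ∀ k (H : MHG n) → ∣ unmarked H ∣ ≤ k →
  e ∈E E H → AtMostOne (e ─ M H) → MakerWin H
trivial⇒MakerWin {e = e} k H bound e∈ one with ∣ unmarked H ∣ ≤? 1
... | yes ≤1 = base ≤1 (e , e∈ , AtMostOne⇒∣p∣≤1 _ one)
trivial⇒MakerWin zero H bound e∈ one | no ≰1 = contradiction (≤-trans bound z≤n) ≰1
trivial⇒MakerWin (suc k) H bound e∈ one | no ≰1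
  with trivialWinningMove H (1≤∣p∣⇒Nonempty _ (≤-trans (s≤s z≤n) (≰⇒> ≰1))) one
... | x , x∈ , avoids = step (≰⇒> ≰1) x x∈ λ y y∈ y≢x →
  trivial⇒MakerWin k (H ⁺ x ⁻ y) (≤-pred (≤-trans (∣unmarked-round∣<∣unmarked∣ H x∈) bound))
    (∈E-delete⁺ (H ⁺ x) e∈ (avoids y∈ y≢x))
    (AtMostOne-⊆ (e─marked-round⊆e─marked H (avoids y∈ y≢x)) one)

MakerWin⇒MakerWin′ : ∀ {H : MHG n} → MakerWin H → MakerWin′ H
MakerWin⇒MakerWin′ (base _ (e , e∈ , ≤1)) = trivial e e∈ (∣p∣≤1⇒AtMostOne ≤1)
MakerWin⇒MakerWin′ {H = H} (step 2≤ x x∈ wins) with 2≤∣p∣⇒another (unmarked H) 2≤ x∈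
... | y₀ , y₀∈ , y₀≢x = move x x∈ y₀ y₀∈ y₀≢x λ y y∈ y≢x → MakerWin⇒MakerWin′ (wins y y∈ y≢x)

MakerWin′⇒MakerWin : ∀ {H : MHG n} → MakerWin′ H → MakerWin H
MakerWin′⇒MakerWin {H = H} (trivial e e∈ one) = trivial⇒MakerWin _ H ≤-refl e∈ one
MakerWin′⇒MakerWin (move x x∈ y₀ y₀∈ y₀≢x wins) =
  step (x≢y⇒2≤∣p∣ y₀∈ x∈ y₀≢x) x x∈ λ y y∈ y≢x → MakerWin′⇒MakerWin (wins y y∈ y≢x)

-- Determinacy

trivialMakerWin? : ∀ (H : MHG n) → Dec (TrivialMakerWin H)
trivialMakerWin? H = map′ find (λ (e , e∈ , ≤1) → lose e∈ ≤1)
  (anyEdge? (λ e → ∣ e ─ M H ∣ ≤? 1) (E H))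

makerWin≤? : ∀ k (H : MHG n) → ∣ unmarked H ∣ ≤ k → Dec (MakerWin H)
makerWin≤? k H bound with ∣ unmarked H ∣ ≤? 1
... | yes ≤1 = map′ (base ≤1) trivialOf (trivialMakerWin? H)
  where
  trivialOf : MakerWin H → TrivialMakerWin H
  trivialOf (base _ t)      = t
  trivialOf (step 2≤ _ _ _) = contradiction (≤-trans 2≤ ≤1) λ { (s≤s ()) }
makerWin≤? zero H bound | no ≰1 = contradiction (≤-trans bound z≤n) ≰1
makerWin≤? (suc k) H bound | no ≰1 = map′ (λ (x , x∈ , wins) → step (≰⇒> ≰1) x x∈ wins)
  (λ { (base ≤1 _) → contradiction ≤1 ≰1 ; (step _ x x∈ wins) → x , x∈ , wins })
  (any? winningMove?)
  where
  winningMove? : ∀ x → Dec (x ∈ unmarked H × (∀ y → y ∈ unmarked H → y ≢ x → MakerWin (H ⁺ x ⁻ y)))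
  winningMove? x with x ∈? unmarked H
  ... | no x∉  = no (x∉ ∘ proj₁)
  ... | yes x∈ = map′ (x∈ ,_) proj₂ (all? λ y →
    (y ∈? unmarked H) →-dec ¬? (y ≟ x) →-dec
    makerWin≤? k (H ⁺ x ⁻ y) (≤-pred (≤-trans (∣unmarked-round∣<∣unmarked∣ H x∈) bound)))

makerWin? : ∀ (H : MHG n) → Dec (MakerWin H)
makerWin? H = makerWin≤? _ H ≤-refl

breakerReply : ∀ (H : MHG n) → BreakerWin H → 2 ≤ ∣ unmarked H ∣ → x ∈ unmarked H →
  ∃ λ y → y ∈ unmarked H × y ≢ x × BreakerWin (H ⁺ x ⁻ y)
breakerReply {x = x} H breakerWins 2≤ x∈
  with any? (λ y → (y ∈? unmarked H) ×-dec ¬? (y ≟ x) ×-dec ¬? (makerWin? (H ⁺ x ⁻ y)))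
... | yes reply = reply
... | no none = contradiction (step 2≤ x x∈ λ y y∈ y≢x → makerWins y y∈ y≢x (makerWin? (H ⁺ x ⁻ y)))
                  breakerWins
  where
  makerWins : ∀ y → y ∈ unmarked H → y ≢ x → Dec (MakerWin (H ⁺ x ⁻ y)) → MakerWin (H ⁺ x ⁻ y)
  makerWins y _  _   (yes wins) = wins
  makerWins y y∈ y≢x (no loses) = contradiction (y , y∈ , y≢x , loses) none

-- Transporting Maker's win along embeddings

-- Edges of D need only be covered: some edge of H inside the image of each edge of D.
record Embedding (D : MHG m) (H : MHG n) (h : Fin m → Fin n) : Set where
  field
    V⁺        : ∀ {v} → v ∈ V D → h v ∈ V H
    injective : ∀ {v w} → v ∈ V D → w ∈ V D → h v ≡ h w → v ≡ w
    covers-E  : ∀ {e} → e ∈E E D →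
                ∃ λ e′ → e′ ∈E E H × (∀ {w} → w ∈ e′ → ∃ λ v → v ∈ e × h v ≡ w)
    M⁺        : ∀ {v} → v ∈ V D → v ∈ M D → h v ∈ M H
    M⁻        : ∀ {v} → v ∈ V D → h v ∈ M H → v ∈ M D
    E⊆V       : ∀ {e} → e ∈E E D → e ⊆ V D

  unmarked⁺ : ∀ {v} → v ∈ unmarked D → h v ∈ unmarked H
  unmarked⁺ v∈ with x∈p─q⁻ (V D) (M D) v∈
  ... | v∈V , v∉M = x∈p∧x∉q⇒x∈p─q (V⁺ v∈V) (v∉M ∘ M⁻ v∈V)

  covers-unmarked-E : ∀ {e} → e ∈E E D →
    ∃ λ e′ → e′ ∈E E H × (∀ {w} → w ∈ e′ ─ M H → ∃ λ v → v ∈ e ─ M D × h v ≡ w)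
  covers-unmarked-E {e} e∈ with covers-E e∈
  ... | e′ , e′∈ , covered = e′ , e′∈ , λ w∈ → pull (x∈p─q⁻ e′ (M H) w∈)
    where
    pull : ∀ {w} → w ∈ e′ × w ∉ M H → ∃ λ v → v ∈ e ─ M D × h v ≡ w
    pull (w∈e′ , w∉M) with covered w∈e′
    ... | v , v∈e , refl = v , x∈p∧x∉q⇒x∈p─q v∈e (w∉M ∘ M⁺ (E⊆V e∈ v∈e)) , refl

embedding-round : ∀ {D : MHG m} {H : MHG n} {h} {x y y′} → Embedding D H h → x ∈ V D →
  (∀ {v} → v ∈ V D → h v ≡ y′ → v ≡ y) → Embedding (D ⁺ x ⁻ y) (H ⁺ h x ⁻ y′) h
embedding-round {D = D} {H} {h} {x} {y} {y′} emb x∈V only-y = record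
  { V⁺        = λ v∈ → let v∈V , v≢y = x∈p-y⁻ (V D) v∈ in
                  x∈p∧x≢y⇒x∈p-y (V⁺ v∈V) (v≢y ∘ only-y v∈V)
  ; injective = λ v∈ w∈ → injective (proj₁ (x∈p-y⁻ (V D) v∈)) (proj₁ (x∈p-y⁻ (V D) w∈))
  ; covers-E  = covers-E′
  ; M⁺        = M⁺′
  ; M⁻        = M⁻′
  ; E⊆V       = λ e∈ v∈e → let e∈D , y∉e = ∈E-delete⁻ (D ⁺ x) e∈ in
                  x∈p∧x≢y⇒x∈p-y (E⊆V e∈D v∈e) λ { refl → y∉e v∈e }
  }
  where
  open Embedding emb
  covers-E′ : ∀ {e} → e ∈E E (D ⁺ x ⁻ y) → ∃ λ e′ → e′ ∈E E (H ⁺ h x ⁻ y′) ×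
                (∀ {w} → w ∈ e′ → ∃ λ v → v ∈ e × h v ≡ w)
  covers-E′ e∈ with ∈E-delete⁻ (D ⁺ x) e∈
  ... | e∈D , y∉e with covers-E e∈D
  ... | e′ , e′∈ , covered = e′ , ∈E-delete⁺ (H ⁺ h x) e′∈ y′∉e′ , covered
    where
    y′∉e′ : y′ ∉ e′
    y′∉e′ y′∈ with covered y′∈
    ... | v , v∈e , hv≡y′ = y∉e (subst (_∈ _) (only-y (E⊆V e∈D v∈e) hv≡y′) v∈e)
  M⁺′ : ∀ {v} → v ∈ V (D ⁺ x ⁻ y) → v ∈ M (D ⁺ x ⁻ y) → h v ∈ M (H ⁺ h x ⁻ y′)
  M⁺′ v∈ v∈M with x∈p-y⁻ (V D) v∈ | ∈p∪⁅x⁆-y⁻ (M D) v∈M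
  ... | v∈V , v≢y | marked , _ = x∈p∧x≢y⇒x∈p-y (x∈p∪⁅y⁆⁺ (image marked)) (v≢y ∘ only-y v∈V)
    where
    image : _ ∈ M D ⊎ _ ≡ x → h _ ∈ M H ⊎ h _ ≡ h x
    image (inj₁ v∈M) = inj₁ (M⁺ v∈V v∈M)
    image (inj₂ refl) = inj₂ refl
  M⁻′ : ∀ {v} → v ∈ V (D ⁺ x ⁻ y) → h v ∈ M (H ⁺ h x ⁻ y′) → v ∈ M (D ⁺ x ⁻ y)
  M⁻′ v∈ hv∈M with x∈p-y⁻ (V D) v∈ | ∈p∪⁅x⁆-y⁻ (M H) hv∈M
  ... | v∈V , v≢y | marked , _ = x∈p∧x≢y⇒x∈p-y (x∈p∪⁅y⁆⁺ (preimage marked)) v≢y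
    where
    preimage : h _ ∈ M H ⊎ h _ ≡ h x → _ ∈ M D ⊎ _ ≡ x
    preimage (inj₁ hv∈M) = inj₁ (M⁻ v∈V hv∈M)
    preimage (inj₂ hv≡hx) = inj₂ (injective v∈V x∈V hv≡hx)

-- Breaker's reply y′ in H is answered in D by its preimage, or by the spare unmarked
-- vertex y₀ when y′ is outside the image of h.
MakerWin′-transport : ∀ {D : MHG m} {H : MHG n} {h} → Embedding D H h → MakerWin′ D → MakerWin′ H
MakerWin′-transport {h = h} emb (trivial e e∈ one) with Embedding.covers-unmarked-E emb e∈
... | e′ , e′∈ , covered = trivial e′ e′∈ (AtMostOne-image h covered one)
MakerWin′-transport {D = D} {H} {h} emb (move x x∈ y₀ y₀∈ y₀≢x wins) =
  move (h x) (unmarked⁺ x∈) (h y₀) (unmarked⁺ y₀∈) (y₀≢x ∘ injective (∈V y₀∈) (∈V x∈)) reply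
  where
  open Embedding emb
  ∈V : ∀ {v} → v ∈ unmarked D → v ∈ V D
  ∈V = proj₁ ∘ x∈p─q⁻ (V D) (M D)
  reply : ∀ y′ → y′ ∈ unmarked H → y′ ≢ h x → MakerWin′ (H ⁺ h x ⁻ y′)
  reply y′ y′∈ y′≢hx with any? (λ v → (v ∈? V D) ×-dec (h v ≟ y′))
  ... | yes (y , y∈V , refl) = MakerWin′-transport
          (embedding-round emb (∈V x∈) λ v∈V hv≡hy → injective v∈V y∈V hv≡hy)
          (wins y y∈ (λ { refl → y′≢hx refl }))
    where
    y∈ : y ∈ unmarked D
    y∈ = x∈p∧x∉q⇒x∈p─q y∈V (proj₂ (x∈p─q⁻ (V H) (M H) y′∈) ∘ M⁺ y∈V)
  ... | no outside-image = MakerWin′-transport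
          (embedding-round emb (∈V x∈) λ v∈V hv≡y′ → contradiction (_ , v∈V , hv≡y′) outside-image)
          (wins y₀ y₀∈ y₀≢x)

-- Dangers

dangerEmbedding : ∀ {H X : MHG n} {D : MHG m} {d} → Subhypergraph X H → WF D →
  x ∈ V X → y ∉ V X → (iso : PointedIso X x D d) → Embedding (D ⁺ d) (H ⁺ x ⁻ y) (PointedIso.g iso)
dangerEmbedding {x = x} {y = y} {H = H} {X} {D} {d} sub wfD x∈X y∉X iso = record
  { V⁺        = λ w∈ → x∈p∧x≢y⇒x∈p-y (V-sub (g-V _ w∈)) (g≢y w∈)
  ; injective = λ v∈ w∈ gv≡gw → trans (sym (fg _ v∈)) (trans (cong f gv≡gw) (fg _ w∈))
  ; covers-E  = covers-E
  ; M⁺        = λ w∈ w∈M → x∈p∧x≢y⇒x∈p-y (x∈p∪⁅y⁆⁺ (marked⁺ w∈ (x∈p∪⁅y⁆⁻ (M D) w∈M))) (g≢y w∈)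
  ; M⁻        = λ w∈ gw∈M → x∈p∪⁅y⁆⁺ (marked⁻ w∈ (proj₁ (∈p∪⁅x⁆-y⁻ (M H) gw∈M)))
  ; E⊆V       = WF.E-sub wfD _
  }
  where
  open PointedIso iso
  open Subhypergraph sub renaming (E-sub to E-subH)
  g≢y : ∀ {w} → w ∈ V D → g w ≢ y
  g≢y w∈ gw≡y = y∉X (subst (_∈ V X) gw≡y (g-V _ w∈))
  g-marked⁻ : ∀ {w} → w ∈ V D → g w ∈ M H → w ∈ M D
  g-marked⁻ w∈ gw∈M = subst (_∈ M D) (fg _ w∈)
    (Equivalence.to (M-pres _ (g-V _ w∈)) (subst (_ ∈_) (sym M-eq) (x∈p∩q⁺ (g-V _ w∈ , gw∈M))))
  g-marked⁺ : ∀ {w} → w ∈ V D → w ∈ M D → g w ∈ M H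
  g-marked⁺ w∈ w∈M = proj₂ (x∈p∩q⁻ (V X) (M H) (subst (_ ∈_) M-eq
    (Equivalence.from (M-pres _ (g-V _ w∈)) (subst (_∈ M D) (sym (fg _ w∈)) w∈M))))
  marked⁺ : ∀ {w} → w ∈ V D → w ∈ M D ⊎ w ≡ d → g w ∈ M H ⊎ g w ≡ x
  marked⁺ w∈ (inj₁ w∈M) = inj₁ (g-marked⁺ w∈ w∈M)
  marked⁺ w∈ (inj₂ refl) = inj₂ (trans (cong g (sym point)) (gf x x∈X))
  marked⁻ : ∀ {w} → w ∈ V D → g w ∈ M H ⊎ g w ≡ x → w ∈ M D ⊎ w ≡ d
  marked⁻ w∈ (inj₁ gw∈M) = inj₁ (g-marked⁻ w∈ gw∈M)
  marked⁻ w∈ (inj₂ gw≡x) = inj₂ (trans (sym (fg _ w∈)) (trans (cong f gw≡x) point))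
  covers-E : ∀ {e′} → e′ ∈E E (D ⁺ d) → ∃ λ e → e ∈E E (H ⁺ x ⁻ y) ×
               (∀ {v} → v ∈ e → ∃ λ w → w ∈ e′ × g w ≡ v)
  covers-E e′∈ with E-bwd _ e′∈
  ... | e , e∈X , image =
    e , ∈E-delete⁺ (H ⁺ x) (E-subH e e∈X) (y∉X ∘ WF.E-sub wf e e∈X) ,
    λ v∈e → f _ , Equivalence.from (image (f _)) (_ , v∈e , refl) , gf _ (WF.E-sub wf e e∈X v∈e)

breakerReply∈Int : ∀ (F : Family) → IsFamilyOfDangers F → ∀ (H : MHG n) →
  BreakerWin H → 2 ≤ ∣ unmarked H ∣ → x ∈ unmarked H →
  ∃ λ y → InInt F H x y × BreakerWin (H ⁺ x ⁻ y)
breakerReply∈Int F dangers H breakerWins 2≤ x∈ with breakerReply H breakerWins 2≤ x∈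
... | y , y∈ , y≢x , breakerStillWins =
  y , (∈unmarked-mark⁺ H y∈ y≢x , y∈danger) , breakerStillWins
  where
  y∈danger : ∀ X → InXF F H _ X → y ∈ V X
  y∈danger X (sub , x∈X , m , D , d , D∈F , iso) with y ∈? V X
  ... | yes y∈X = y∈X
  ... | no y∉X with dangers m D d D∈F
  ...   | wfD , _ , makerWinsD = contradiction
    (MakerWin′⇒MakerWin (MakerWin′-transport (dangerEmbedding sub wfD x∈X y∉X iso)
                                              (MakerWin⇒MakerWin′ makerWinsD)))
    breakerStillWins

J-suc-of-BreakerWin : ∀ (F : Family) → IsFamilyOfDangers F → ∀ r (H : MHG n) →
  2 * suc r ≤ ∣ unmarked H ∣ → BreakerWin H → J (suc r) F H
J-suc-of-BreakerWin F dangers zero H 2≤ breakerWins x x∈ =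
  let y , y∈Int , _ = breakerReply∈Int F dangers H breakerWins 2≤ x∈ in y , y∈Int
J-suc-of-BreakerWin F dangers (suc r) H 2r+4≤ breakerWins x x∈ =
  let y , y∈Int , breakerStillWins = breakerReply∈Int F dangers H breakerWins 2≤ x∈
  in y , y∈Int , J-suc-of-BreakerWin F dangers r (H ⁺ x ⁻ y) (enough y) breakerStillWins
  where
  2r+4≤′ : suc (suc (2 * suc r)) ≤ ∣ unmarked H ∣
  2r+4≤′ = subst (_≤ ∣ unmarked H ∣) (*-suc 2 (suc r)) 2r+4≤
  2≤ : 2 ≤ ∣ unmarked H ∣
  2≤ = ≤-trans (s≤s (s≤s z≤n)) 2r+4≤′
  enough : ∀ y → 2 * suc r ≤ ∣ unmarked (H ⁺ x ⁻ y) ∣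
  enough y = ≤-pred (≤-pred (≤-trans 2r+4≤′ (∣unmarked∣≤2+∣unmarked-round∣ H x y)))

mainTheorem13 : (F : Family) → IsFamilyOfDangers F → (r : ℕ) → 1 ≤ r →
    ∀ {n} (H : MHG n) → WF H → 2 * r ≤ ∣ unmarked H ∣ →
    BreakerWin H → J r F H
mainTheorem13 F dangers (suc r) _ H _ = J-suc-of-BreakerWin F dangers r H
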